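{- Let $D$ be a diagram of a spatial graph $G$ on a closed surface $F$ which is cellularly embedded, with projection $\widehat{G}$ connected. Then $\beta_1(S_A(D))+\beta_1(S_B(D))\le s(\widehat{G})-\chi(G)+c(D)-\chi(F)+2$.
   Context: $G$ is a finite graph, $\chi(G)$ its Euler characteristic and $\beta_0,\beta_1$ denote number of components and first Betti number. A diagram $D$ of $G$ on a closed surface $F$ is a generic immersion of $G$ in $F$ whose double points are crossings with over/under information; $c(D)$ is the number of crossings, and the projection (shadow) $\widehat{G}$ is the immersed graph in $F$ (crossings regarded as 4-valent vertices). $D$ is cellularly embedded if every region of $F\setminus\widehat{G}$ is an open disk. $S_A(D)$ (resp. $S_B(D)$) is the graph obtained by replacing every crossing by its A-smoothing (resp. B-smoothing) in the sense of Kauffman. The dual graph $G^*$ has one vertex for each disk region of $F\setminus\widehat{G}$ and, for each crossing $x$ of $\widehat{G}$, two edges, each joining a pair of opposite regions incident at $x$ (one pair being joined through the A-smoothing, the other through the B-smoothing). $s(\widehat{G})=\beta_0(G^*)$. -}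

module Defs where

open import Data.Nat using (ℕ; _<_)
open import Data.Fin using (Fin)
open import Data.Bool using (Bool; true; false; not)
open import Data.Integer using (ℤ; +_; _-_; _+_)
open import Data.Product using (Σ; ∃; _×_; _,_; proj₁)
open import Data.Sum using (_⊎_)
open import Relation.Binary.PropositionalEquality using (_≡_; _≢_)
open import Relation.Binary.Construct.Closure.Equivalence using (EqClosure)

record HasClasses {A : Set} (R : A → A → Set) (k : ℕ) : Set where
  field
    cls         : A → Fin k
    cls-surj    : ∀ j → ∃ λ a → cls a ≡ j
    cls-resp    : ∀ {a b} → R a b → cls a ≡ cls b
    cls-reflect : ∀ {a b} → cls a ≡ cls b → EqClosure R a b

data _∪ʳ_ {A : Set} (R S : A → A → Set) (a b : A) : Set where
  inl : R a b → (R ∪ʳ S) a b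
  inr : S a b → (R ∪ʳ S) a b

-- Graphs presented by "flags": a finite set A of flags, every flag lies
-- on exactly one vertex and one edge; vertices = classes of vRel,
-- edges = classes of eRel, incidence = sharing a flag.
record FlagGraph (A : Set) : Set₁ where
  field
    vRel : A → A → Set
    eRel : A → A → Set

module _ {A : Set} (Γ : FlagGraph A) where
  open FlagGraph Γ

  EulerChar : ℤ → Set
  EulerChar x = Σ ℕ λ v → Σ ℕ λ e →
    HasClasses vRel v × HasClasses eRel e × x ≡ (+ v) - (+ e)

  Betti0 : ℕ → Set
  Betti0 k = HasClasses (vRel ∪ʳ eRel) k

  Betti1 : ℕ → Set
  Betti1 b = Σ ℕ λ v → Σ ℕ λ e → Σ ℕ λ k →
    HasClasses vRel v × HasClasses eRel e × Betti0 k ×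
    (+ b) ≡ ((+ e) - (+ v)) + (+ k)

-- Connected graphs cellularly embedded in closed surfaces, as
-- combinatorial maps in flag form (τ₀: change vertex, τ₁: change edge,
-- τ₂: change face).
record Map : Set where
  field
    n          : ℕ
    nonempty   : 0 < n
    τ₀ τ₁ τ₂   : Fin n → Fin n
    τ₀-invol   : ∀ f → τ₀ (τ₀ f) ≡ f
    τ₁-invol   : ∀ f → τ₁ (τ₁ f) ≡ f
    τ₂-invol   : ∀ f → τ₂ (τ₂ f) ≡ f
    τ₀-fpf     : ∀ f → τ₀ f ≢ f
    τ₁-fpf     : ∀ f → τ₁ f ≢ f
    τ₂-fpf     : ∀ f → τ₂ f ≢ f
    τ₀τ₂-comm  : ∀ f → τ₀ (τ₂ f) ≡ τ₂ (τ₀ f)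
    τ₀τ₂-fpf   : ∀ f → τ₀ (τ₂ f) ≢ f
    connected  : ∀ f g → EqClosure (λ x y → (y ≡ τ₀ x) ⊎ (y ≡ τ₁ x) ⊎ (y ≡ τ₂ x)) f g

module _ (M : Map) where
  open Map M

  -- rotation around a vertex by one edge-end
  ρ : Fin n → Fin n
  ρ f = τ₂ (τ₁ f)

  -- ρ² f : flag in the opposite edge-end / opposite corner at a 4-valent vertex
  ρ² : Fin n → Fin n
  ρ² f = ρ (ρ f)

  data HatV : Fin n → Fin n → Set where
    v₁ : ∀ f → HatV f (τ₁ f)
    v₂ : ∀ f → HatV f (τ₂ f)

  data HatE : Fin n → Fin n → Set where
    e₀ : ∀ f → HatE f (τ₀ f)
    e₂ : ∀ f → HatE f (τ₂ f)

  data HatF : Fin n → Fin n → Set where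
    f₀ : ∀ f → HatF f (τ₀ f)
    f₁ : ∀ f → HatF f (τ₁ f)

  SurfaceEuler : ℤ → Set
  SurfaceEuler x = Σ ℕ λ v → Σ ℕ λ e → Σ ℕ λ fc →
    HasClasses HatV v × HasClasses HatE e × HasClasses HatF fc ×
    x ≡ ((+ v) - (+ e)) + (+ fc)

  -- A diagram: a set of 4-valent vertices of Ĝ declared crossings
  -- (cr, constant on vertices), together with the over/under
  -- information encoded as the choice, at each crossing, of which pair
  -- of opposite corners are the A-corners (aPair f ≡ true iff the corner
  -- {f, τ₁ f} is an A-corner).
  record Diagram : Set where
    field
      cr        : Fin n → Bool
      cr-τ₁     : ∀ f → cr (τ₁ f) ≡ cr f
      cr-τ₂     : ∀ f → cr (τ₂ f) ≡ cr f
      cr-deg4   : ∀ f → cr f ≡ true → ρ² (ρ² f) ≡ f × ρ² f ≢ f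
      aPair     : Fin n → Bool
      aPair-τ₁  : ∀ f → cr f ≡ true → aPair (τ₁ f) ≡ aPair f
      aPair-τ₂  : ∀ f → cr f ≡ true → aPair (τ₂ f) ≡ not (aPair f)

  module _ (D : Diagram) where
    open Diagram D

    CrFlag : Set
    CrFlag = Σ (Fin n) λ f → cr f ≡ true

    CrV : CrFlag → CrFlag → Set
    CrV a b = HatV (proj₁ a) (proj₁ b)

    CrossingNumber : ℕ → Set
    CrossingNumber c = HasClasses CrV c

    -- The spatial graph G (with each crossing replaced by two degree-2
    -- subdivision vertices, one on each strand; this does not change G
    -- up to homeomorphism).
    data GV : Fin n → Fin n → Set where
      gv₁ : ∀ f → cr f ≡ false → GV f (τ₁ f)
      gv₂ : ∀ f → GV f (τ₂ f)
      gvs : ∀ f → cr f ≡ true → GV f (ρ² f)    -- opposite edge-ends = one strand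

    graphG : FlagGraph (Fin n)
    graphG = record { vRel = GV ; eRel = HatE }

    -- At a crossing, the smoothing arcs hug the corners of
    -- one opposite pair, merging the regions of the other pair.
    -- smoothing b: arcs hug the corners with aPair ≡ b.
    -- S_A(D) (merging the A-regions) = smoothing false,
    -- S_B(D) (merging the B-regions) = smoothing true.
    data SV (b : Bool) : Fin n → Fin n → Set where
      sv₁ : ∀ f → cr f ≡ false → SV b f (τ₁ f)
      sv₂ : ∀ f → SV b f (τ₂ f)
      svc : ∀ f → cr f ≡ true → aPair f ≡ b → SV b f (τ₁ f)

    smoothing : Bool → FlagGraph (Fin n)
    smoothing b = record { vRel = SV b ; eRel = HatE }

    S-A : FlagGraph (Fin n)
    S-A = smoothing false

    S-B : FlagGraph (Fin n)
    S-B = smoothing true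

    -- Dual graph G*: vertices = regions; at each crossing x two edges,
    -- joining the regions of opposite corners {f,τ₁f} and {ρ²f,τ₁ρ²f}.
    data DualE : Fin n → Fin n → Set where
      de : ∀ f → cr f ≡ true → DualE f (ρ² f)

    DualComponents : ℕ → Set
    DualComponents s = HasClasses (HatF ∪ʳ DualE) s

{-# OPTIONS --safe #-}
module Submission where

-- Number the crossings and restore them one at a time, passing from the state S_t
-- (t = A, B) to the projection Ĝ.  Restoring a crossing fuses two vertices into one, so
-- #V(S_t) = #V(Ĝ) + c; likewise G, whose two strands meet at each restored crossing, has at
-- most #V(Ĝ) + c vertices.  Along the way track the regions of F, merged across the two
-- corners not hugged by t at every crossing that is still smoothed.  Restoring a crossing
-- cannot both join two components and split a region (a parity count of flags), so
-- components minus regions drops by at most one per crossing: β₀(S_t) + #F(Ĝ) ≤ 1 + c + r_t,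
-- with r_t the number of merged regions when every crossing is smoothed.  Adding the merges
-- across the corners of the other kind, crossing by crossing, is submodular, whence
-- r_A + r_B ≤ s(Ĝ) + #F(Ĝ).

open import Defs
open import Level using (0ℓ)
open import Function using (_∘_; _$_; id)
open import Data.Empty using (⊥; ⊥-elim)
open import Data.Bool using (Bool; true; false; not; if_then_else_)
import Data.Bool.Properties as Bool
open import Data.Nat using (ℕ; zero; suc)
open import Data.Fin using (Fin; zero; suc; toℕ; fromℕ<; punchIn; punchOut)
open import Data.Fin.Properties using (_≟_; injective⇒≤; punchOut-injective; punchOut-cong; punchInᵢ≢i; punchOut-punchIn; toℕ<n; toℕ-injective; toℕ-fromℕ<)
import Data.Fin.Properties as Fin
open import Data.Product as Product using (Σ-syntax; ∃; ∃-syntax; uncurry; _×_; _,_; proj₁; proj₂)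
open import Data.Sum as Sum using (_⊎_; inj₁; inj₂)
open import Data.List using (List; []; _∷_; filter; cartesianProduct; allFin)
open import Data.List.Relation.Unary.Any using (here; there)
open import Data.List.Membership.Propositional using (_∈_)
open import Data.List.Membership.Propositional.Properties using (∈-filter⁺; ∈-filter⁻; ∈-cartesianProduct⁺; ∈-allFin)
open import Relation.Nullary using (¬_; Dec; yes; no; does; contradiction)
open import Relation.Nullary.Decidable using (map′; _×-dec_; _⊎-dec_; _→-dec_)
open import Relation.Unary as U using (Pred; _∩_; ∁)
open import Relation.Unary.Properties using (_∩?_; ∁?)
open import Relation.Binary using (Rel; _⇒_; Decidable)
open import Relation.Binary.PropositionalEquality
open import Relation.Binary.Construct.Closure.Equivalence as EC using (EqClosure)
open import Relation.Binary.Construct.Closure.ReflexiveTransitive as Star using (ε; _◅◅_)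
open import Relation.Binary.Construct.Closure.Symmetric using (SymClosure; fwd; bwd)
open import Axiom.UniquenessOfIdentityProofs using (module Decidable⇒UIP)

module ClassCounting where

  open import Data.Nat using (_+_; _≤_)
  open import Data.Nat.Properties using (≤-antisym; ≤-reflexive; n≤1+n; +-monoʳ-≤; +-suc)

  module _ {A : Set} where

    infix 4 _⇒*_ _≈*_

    _⇒*_ : Rel A 0ℓ → Rel A 0ℓ → Set
    R ⇒* S = R ⇒ EqClosure S

    _≈*_ : Rel A 0ℓ → Rel A 0ℓ → Set
    R ≈* S = R ⇒* S × S ⇒* R

    data Link (a b : A) : Rel A 0ℓ where
      link : Link a b a b

    closure-⇒* : {R S : Rel A 0ℓ} → R ⇒* S → EqClosure R ⇒ EqClosure S
    closure-⇒* {S = S} = EC.fold (EC.isEquivalence S)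

    ∪-⇒* : {R S T : Rel A 0ℓ} → R ⇒* T → S ⇒* T → (R ∪ʳ S) ⇒* T
    ∪-⇒* f g (inl r) = f r
    ∪-⇒* f g (inr s) = g s

    ⇒*-∪ˡ : {R S : Rel A 0ℓ} → R ⇒* (R ∪ʳ S)
    ⇒*-∪ˡ = EC.return ∘ inl

    linked : {R : Rel A 0ℓ} {a b : A} → EqClosure (R ∪ʳ Link a b) a b
    linked = EC.return (inr link)

    closure-preserves : {R : Rel A 0ℓ} (P : Pred A 0ℓ) →
      (∀ {x y} → R x y → P x → P y) → (∀ {x y} → R x y → P y → P x) →
      ∀ {x y} → EqClosure R x y → P x → P y
    closure-preserves {R} P forward backward = Star.fold (λ x y → P x → P y) (λ s g → g ∘ step s) id
      where
      step : ∀ {x y} → SymClosure R x y → P x → P y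
      step (fwd r) = forward r
      step (bwd r) = backward r

  module HasClassesProperties {A : Set} {R : Rel A 0ℓ} {k : ℕ} (H : HasClasses R k) where
    open HasClasses H public

    cls-resp* : ∀ {x y} → EqClosure R x y → cls x ≡ cls y
    cls-resp* = EC.gfold isEquivalence cls cls-resp

    rep : Fin k → A
    rep j = proj₁ (cls-surj j)

    cls-rep : ∀ j → cls (rep j) ≡ j
    cls-rep j = proj₂ (cls-surj j)

    related? : Decidable (EqClosure R)
    related? x y = map′ cls-reflect cls-resp* (cls x ≟ cls y)

  module _ {A : Set} {R S : Rel A 0ℓ} where

    classes-antitone : ∀ {k l} → R ⇒* S → HasClasses R k → HasClasses S l → l ≤ k
    classes-antitone R⇒S H G = injective⇒≤ λ {i} {j} eq →
      trans (sym (G.cls-rep i)) (trans (G.cls-resp* (closure-⇒* R⇒S (H.cls-reflect eq))) (G.cls-rep j))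
      where
      module H = HasClassesProperties H
      module G = HasClassesProperties G

    HasClasses-≈* : ∀ {k} → R ≈* S → HasClasses R k → HasClasses S k
    HasClasses-≈* (R⇒S , S⇒R) H = record
      { cls = cls ; cls-surj = cls-surj
      ; cls-resp = cls-resp* ∘ S⇒R
      ; cls-reflect = closure-⇒* R⇒S ∘ cls-reflect }
      where open HasClassesProperties H

  classes-unique : ∀ {A : Set} {R : Rel A 0ℓ} {k l} → HasClasses R k → HasClasses R l → k ≡ l
  classes-unique H G = ≤-antisym (classes-antitone EC.return G H) (classes-antitone EC.return H G)

  module _ {A : Set} {R : Rel A 0ℓ} {a b : A} where

    HasClasses-link-within : ∀ {k} → HasClasses R k → EqClosure R a b → HasClasses (R ∪ʳ Link a b) k
    HasClasses-link-within H a~b = record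
      { cls = cls ; cls-surj = cls-surj
      ; cls-resp = λ { (inl r) → cls-resp r ; (inr link) → cls-resp* a~b }
      ; cls-reflect = closure-⇒* ⇒*-∪ˡ ∘ cls-reflect }
      where open HasClassesProperties H

    -- The class of b is merged into that of a; punchOut then deletes its now unused index.
    private module Merge {k} (H : HasClasses R (suc k)) (a≁b : ¬ EqClosure R a b) where
      open HasClassesProperties H

      merge : Fin (suc k) → Fin (suc k)
      merge i with i ≟ cls b
      ... | yes _ = cls a
      ... | no _  = i

      merge-b : merge (cls b) ≡ cls a
      merge-b with cls b ≟ cls b
      ... | yes _ = refl
      ... | no b≢b = contradiction refl b≢b

      merge-a : merge (cls a) ≡ cls a
      merge-a with cls a ≟ cls b
      ... | yes _ = refl
      ... | no _  = refl

      merge-other : ∀ {i} → i ≢ cls b → merge i ≡ i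
      merge-other {i} i≢b with i ≟ cls b
      ... | yes i≡b = contradiction i≡b i≢b
      ... | no _    = refl

      merge-≢ : ∀ i → cls b ≢ merge i
      merge-≢ i with i ≟ cls b
      ... | yes _   = a≁b ∘ cls-reflect ∘ sym
      ... | no i≢b  = i≢b ∘ sym

      merged-cls : A → Fin k
      merged-cls x = punchOut (merge-≢ (cls x))

      witness : ∀ x → ∃[ z ] cls z ≡ merge (cls x) × EqClosure (R ∪ʳ Link a b) x z
      witness x = case-on (cls x ≟ cls b)
        where
        case-on : Dec (cls x ≡ cls b) → ∃[ z ] cls z ≡ merge (cls x) × EqClosure (R ∪ʳ Link a b) x z
        case-on (yes x~b) = a , trans (sym merge-b) (cong merge (sym x~b))
                              , closure-⇒* ⇒*-∪ˡ (cls-reflect x~b) ◅◅ EC.symmetric _ linked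
        case-on (no x≁b)  = x , sym (merge-other x≁b) , ε

    HasClasses-link-across : ∀ {k} → HasClasses R (suc k) → ¬ EqClosure R a b → HasClasses (R ∪ʳ Link a b) k
    HasClasses-link-across H a≁b = record
      { cls = merged-cls ; cls-surj = surj ; cls-resp = resp′ ; cls-reflect = reflect }
      where
      open HasClassesProperties H
      open Merge H a≁b

      surj : ∀ j → ∃[ x ] merged-cls x ≡ j
      surj j = rep i , trans (punchOut-cong (cls b) (trans (merge-other i≢b′) (cls-rep i))) (punchOut-punchIn (cls b))
        where
        i = punchIn (cls b) j
        i≢b′ : cls (rep i) ≢ cls b
        i≢b′ eq = punchInᵢ≢i (cls b) j (trans (sym (cls-rep i)) eq)

      resp′ : ∀ {x y} → (R ∪ʳ Link a b) x y → merged-cls x ≡ merged-cls y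
      resp′ (inl r)    = punchOut-cong (cls b) (cong merge (cls-resp r))
      resp′ (inr link) = punchOut-cong (cls b) (trans merge-a (sym merge-b))

      reflect : ∀ {x y} → merged-cls x ≡ merged-cls y → EqClosure (R ∪ʳ Link a b) x y
      reflect {x} {y} eq with witness x | witness y
      ... | zx , zx-cls , x~zx | zy , zy-cls , y~zy =
        x~zx ◅◅ closure-⇒* ⇒*-∪ˡ (cls-reflect zx~zy) ◅◅ EC.symmetric _ y~zy
        where
        zx~zy : cls zx ≡ cls zy
        zx~zy = trans zx-cls (trans (punchOut-injective (merge-≢ (cls x)) (merge-≢ (cls y)) eq) (sym zy-cls))

    classes-∪-Link : ∀ {k} → HasClasses R k → ∃ (HasClasses (R ∪ʳ Link a b))
    classes-∪-Link {k} H with HasClassesProperties.related? H a b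
    ... | yes a~b = k , HasClasses-link-within H a~b
    ... | no a≁b with k | H
    ...   | zero  | H₀ = contradiction (HasClasses.cls H₀ a) λ ()
    ...   | suc k′ | H′ = k′ , HasClasses-link-across H′ a≁b

    classes-link-within : ∀ {k l} → HasClasses R k → HasClasses (R ∪ʳ Link a b) l → EqClosure R a b → l ≡ k
    classes-link-within H G a~b = classes-unique G (HasClasses-link-within H a~b)

    classes-link-across : ∀ {k l} → HasClasses R k → HasClasses (R ∪ʳ Link a b) l → ¬ EqClosure R a b → k ≡ suc l
    classes-link-across {zero}  H G a≁b = contradiction (HasClasses.cls H a) λ ()
    classes-link-across {suc k} H G a≁b = cong suc (classes-unique (HasClasses-link-across H a≁b) G)

    classes-link-≤ : ∀ {k l} → HasClasses R k → HasClasses (R ∪ʳ Link a b) l → k ≤ suc l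
    classes-link-≤ H G with HasClassesProperties.related? H a b
    ... | yes a~b = subst (λ l → _ ≤ suc l) (sym (classes-link-within H G a~b)) (n≤1+n _)
    ... | no a≁b  = ≤-reflexive (classes-link-across H G a≁b)

  classes-link-submodular : ∀ {A : Set} {R S : Rel A 0ℓ} {a b : A} {k k′ l l′} → R ⇒* S →
    HasClasses R k → HasClasses (R ∪ʳ Link a b) k′ → HasClasses S l → HasClasses (S ∪ʳ Link a b) l′ →
    l + k′ ≤ l′ + k
  classes-link-submodular {a = a} {b} {k′ = k′} {l} R⇒S H H′ G G′ with HasClassesProperties.related? G a b
  ... | yes a~b = subst (λ l′ → l + k′ ≤ l′ + _) (sym (classes-link-within G G′ a~b))
                    (+-monoʳ-≤ l (classes-antitone ⇒*-∪ˡ H H′))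
  ... | no a≁b rewrite classes-link-across G G′ a≁b | classes-link-across H H′ (a≁b ∘ closure-⇒* R⇒S) =
    ≤-reflexive (sym (+-suc _ k′))

  module _ {n : ℕ} where

    PairsIn : List (Fin n × Fin n) → Rel (Fin n) 0ℓ
    PairsIn L x y = (x , y) ∈ L

    classes-PairsIn : (L : List (Fin n × Fin n)) → ∃ (HasClasses (PairsIn L))
    classes-PairsIn [] = n , record
      { cls = id ; cls-surj = λ j → j , refl ; cls-resp = λ () ; cls-reflect = λ { refl → ε } }
    classes-PairsIn ((a , b) ∷ L) =
      Product.map₂ (HasClasses-≈* (∪-⇒* (EC.return ∘ there) (λ { link → EC.return (here refl) }) , cons))
                   (classes-∪-Link (proj₂ (classes-PairsIn L)))
      where
      cons : PairsIn ((a , b) ∷ L) ⇒* (PairsIn L ∪ʳ Link a b)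
      cons (here refl) = linked
      cons (there p)   = EC.return (inl p)

    classes-exist : {R : Rel (Fin n) 0ℓ} → Decidable R → ∃ (HasClasses R)
    classes-exist {R} R? = Product.map₂ (HasClasses-≈* (to , from)) (classes-PairsIn L)
      where
      R?′ : U.Decidable (uncurry R)
      R?′ (x , y) = R? x y
      L = filter R?′ (cartesianProduct (allFin n) (allFin n))
      to : PairsIn L ⇒* R
      to p = EC.return (proj₂ (∈-filter⁻ R?′ {xs = cartesianProduct (allFin n) (allFin n)} p))
      from : R ⇒* PairsIn L
      from {x} {y} r = EC.return (∈-filter⁺ R?′ (∈-cartesianProduct⁺ (∈-allFin x) (∈-allFin y)) r)

    #classes : {R : Rel (Fin n) 0ℓ} → Decidable R → ℕ
    #classes R? = proj₁ (classes-exist R?)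

    #classes-correct : {R : Rel (Fin n) 0ℓ} (R? : Decidable R) → HasClasses R (#classes R?)
    #classes-correct R? = proj₂ (classes-exist R?)

  module _ {A : Set} where

    Along : (A → A) → Rel A 0ℓ
    Along h x y = y ≡ h x

    AlongAt : Pred A 0ℓ → (A → A) → Rel A 0ℓ
    AlongAt P h x y = P x × y ≡ h x

    guarded-step : ∀ {P P′ Q : Pred A 0ℓ} {h : A → A} {T : Rel A 0ℓ} {a : A} →
      P U.⊆ P′ → P′ U.⊆ P U.∪ Q → P′ a →
      (∀ {x} → Q x → EqClosure ((AlongAt P h ∪ʳ T) ∪ʳ Link a (h a)) x (h x)) →
      (AlongAt P′ h ∪ʳ T) ≈* ((AlongAt P h ∪ʳ T) ∪ʳ Link a (h a))
    guarded-step {P} {P′} {Q} {h} {T} {a} P⊆P′ P′⊆P∪Q P′a extra = to , from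
      where
      to : (AlongAt P′ h ∪ʳ T) ⇒* ((AlongAt P h ∪ʳ T) ∪ʳ Link a (h a))
      to (inl (p′ , refl)) with P′⊆P∪Q p′
      ... | inj₁ p = EC.return (inl (inl (p , refl)))
      ... | inj₂ q = extra q
      to (inr t) = EC.return (inl (inr t))
      from : ((AlongAt P h ∪ʳ T) ∪ʳ Link a (h a)) ⇒* (AlongAt P′ h ∪ʳ T)
      from (inl (inl (p , refl))) = EC.return (inl (P⊆P′ p , refl))
      from (inl (inr t))          = EC.return (inr t)
      from (inr link)             = EC.return (inl (P′a , refl))

  #classes-≈* : ∀ {n} {R S : Rel (Fin n) 0ℓ} {k} → R ≈* S → (R? : Decidable R) → HasClasses S k → #classes R? ≡ k
  #classes-≈* R≈S R? H = classes-unique (HasClasses-≈* R≈S (#classes-correct R?)) H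

open ClassCounting

module SubsetCounting where

  open import Data.Nat using (_+_; s≤s)
  open import Data.Nat.Properties using (+-suc; +-comm)
  import Data.Nat.Properties as ℕ
  open import Data.Nat.Divisibility using (_∣_; divides; ∣-refl; ∣m∣n⇒∣m+n; ∣m+n∣m⇒∣n; ∣⇒≤)

  count : ∀ {n} {P : Pred (Fin n) 0ℓ} → U.Decidable P → ℕ
  count {zero}  P? = 0
  count {suc n} P? = (if does (P? zero) then 1 else 0) + count (P? ∘ suc)

  count-split : ∀ {n} {P Q : Pred (Fin n) 0ℓ} (P? : U.Decidable P) (Q? : U.Decidable Q) →
    count P? ≡ count (P? ∩? Q?) + count (P? ∩? ∁? Q?)
  count-split {zero} _ _ = refl
  count-split {suc n} P? Q? with P? zero | Q? zero
  ... | yes _ | yes _ = cong suc (count-split (P? ∘ suc) (Q? ∘ suc))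
  ... | yes _ | no _  = trans (cong suc (count-split (P? ∘ suc) (Q? ∘ suc))) (sym (+-suc _ _))
  ... | no _  | _     = count-split (P? ∘ suc) (Q? ∘ suc)

  count-cong : ∀ {n} {P Q : Pred (Fin n) 0ℓ} (P? : U.Decidable P) (Q? : U.Decidable Q) →
    (∀ {x} → P x → Q x) → (∀ {x} → Q x → P x) → count P? ≡ count Q?
  count-cong {zero} _ _ _ _ = refl
  count-cong {suc n} P? Q? P⇒Q Q⇒P with P? zero | Q? zero
  ... | yes _ | yes _ = cong suc (count-cong (P? ∘ suc) (Q? ∘ suc) P⇒Q Q⇒P)
  ... | no _  | no _  = count-cong (P? ∘ suc) (Q? ∘ suc) P⇒Q Q⇒P
  ... | yes p | no ¬q = contradiction (P⇒Q p) ¬q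
  ... | no ¬p | yes q = contradiction (Q⇒P q) ¬p

  remove-suc : ∀ {n} {P : Pred (Fin (suc n)) 0ℓ} (P? : U.Decidable P) z →
    count ((P? ∘ suc) ∩? ∁? (_≟ z)) ≡ count ((P? ∩? ∁? (_≟ suc z)) ∘ suc)
  remove-suc P? z = count-cong ((P? ∘ suc) ∩? ∁? (_≟ z)) ((P? ∩? ∁? (_≟ suc z)) ∘ suc)
    (λ (p , x≢z) → p , x≢z ∘ Fin.suc-injective) (λ (p , x≢z) → p , x≢z ∘ cong suc)

  count-remove : ∀ {n} {P : Pred (Fin n) 0ℓ} (P? : U.Decidable P) {z} → P z →
    count P? ≡ suc (count (P? ∩? ∁? (_≟ z)))
  count-remove {suc n} P? {zero} pz with P? zero
  ... | yes _  = cong suc (count-cong (P? ∘ suc) _ (λ p → p , λ ()) proj₁)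
  ... | no ¬pz = contradiction pz ¬pz
  count-remove {suc n} P? {suc z} pz with P? zero
  ... | yes _ = cong suc (trans (count-remove (P? ∘ suc) pz) (cong suc (remove-suc P? z)))
  ... | no _  = trans (count-remove (P? ∘ suc) pz) (cong suc (remove-suc P? z))

  count-witness : ∀ {n} {P : Pred (Fin n) 0ℓ} (P? : U.Decidable P) {k} → count P? ≡ suc k → ∃ P
  count-witness {suc n} P? eq with P? zero
  ... | yes p = zero , p
  ... | no _  = Product.map suc id (count-witness (P? ∘ suc) eq)

  record FreeInvolution {n} (P : Pred (Fin n) 0ℓ) (σ : Fin n → Fin n) : Set where
    field
      closed           : ∀ {x} → P x → P (σ x)
      involutive       : ∀ {x} → P x → σ (σ x) ≡ x
      fixed-point-free : ∀ {x} → P x → σ x ≢ x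

  module _ {n} {σ : Fin n → Fin n} where

    FreeInvolution-remove : ∀ {P : Pred (Fin n) 0ℓ} → FreeInvolution P σ → ∀ {z} → P z →
      FreeInvolution ((P ∩ ∁ (_≡ z)) ∩ ∁ (_≡ σ z)) σ
    FreeInvolution-remove ι {z} pz = record
      { closed = λ ((p , x≢z) , x≢σz) →
          (closed p , λ σx≡z → x≢σz (trans (sym (involutive p)) (cong σ σx≡z)))
        , λ σx≡σz → x≢z (trans (sym (involutive p)) (trans (cong σ σx≡σz) (involutive pz)))
      ; involutive = involutive ∘ proj₁ ∘ proj₁
      ; fixed-point-free = fixed-point-free ∘ proj₁ ∘ proj₁ }
      where open FreeInvolution ι

    count-pair : ∀ {P : Pred (Fin n) 0ℓ} (P? : U.Decidable P) → FreeInvolution P σ → ∀ {z} → P z →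
      count P? ≡ suc (suc (count ((P? ∩? ∁? (_≟ z)) ∩? ∁? (_≟ σ z))))
    count-pair P? ι {z} pz = trans (count-remove P? pz) (cong suc (count-remove (P? ∩? ∁? (_≟ z)) (closed pz , fixed-point-free pz)))
      where open FreeInvolution ι

    count-even : ∀ {P : Pred (Fin n) 0ℓ} (P? : U.Decidable P) → FreeInvolution P σ → 2 ∣ count P?
    count-even P? ι = go _ P? ι refl
      where
      go : ∀ k {P : Pred (Fin n) 0ℓ} (P? : U.Decidable P) → FreeInvolution P σ → count P? ≡ k → 2 ∣ k
      go zero _ _ _ = divides 0 refl
      go (suc zero) P? ι eq =
        let z , pz = count-witness P? eq in contradiction (trans (sym eq) (count-pair P? ι pz)) λ ()
      go (suc (suc k)) P? ι eq =
        let z , pz = count-witness P? eq in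
        ∣m∣n⇒∣m+n ∣-refl (go k _ (FreeInvolution-remove ι pz)
                            (ℕ.suc-injective (ℕ.suc-injective (trans (sym (count-pair P? ι pz)) eq))))

  odd-not-even : ∀ {k} → 2 ∣ k → ¬ 2 ∣ suc k
  odd-not-even {k} 2∣k 2∣1+k with ∣⇒≤ (∣m+n∣m⇒∣n (subst (2 ∣_) (+-comm 1 k) 2∣1+k) 2∣k)
  ... | s≤s ()

open SubsetCounting

module Telescoping where

  open import Data.Nat using (_+_; _≤_; _<_)
  open import Data.Nat.Properties using (≤-refl; ≤-reflexive; ≤-trans; n<1+n; m<n⇒m<1+n; +-suc; +-mono-≤; +-monoʳ-≤; +-cancelʳ-≤; module ≤-Reasoning)
  open import Data.Nat.Tactic.RingSolver using (solve-∀)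

  telescope : (A B : ℕ → ℕ) (c : ℕ) → (∀ m → m < c → A m + B (suc m) ≤ A (suc m) + B m) →
    A 0 + B c ≤ A c + B 0
  telescope A B zero    step = ≤-refl
  telescope A B (suc c) step = +-cancelʳ-≤ (A c + B c) _ _ (begin
    A 0 + B (suc c) + (A c + B c)    ≡⟨ regroup (A 0) (B (suc c)) (A c) (B c) ⟩
    A 0 + B c + (A c + B (suc c))    ≤⟨ +-mono-≤ (telescope A B c λ m m<c → step m (m<n⇒m<1+n m<c)) (step c (n<1+n c)) ⟩
    A c + B 0 + (A (suc c) + B c)    ≡⟨ regroup′ (A c) (B 0) (A (suc c)) (B c) ⟩
    A (suc c) + B 0 + (A c + B c)    ∎)
    where
    open ≤-Reasoning
    regroup : ∀ a b c d → a + b + (c + d) ≡ a + d + (c + b)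
    regroup = solve-∀
    regroup′ : ∀ a b c d → a + b + (c + d) ≡ c + b + (a + d)
    regroup′ = solve-∀

  drift-≤ : (f : ℕ → ℕ) (c : ℕ) → (∀ m → m < c → f m ≤ suc (f (suc m))) → f 0 ≤ c + f c
  drift-≤ f zero    step = ≤-refl
  drift-≤ f (suc c) step = ≤-trans (drift-≤ f c λ m m<c → step m (m<n⇒m<1+n m<c))
    (≤-trans (+-monoʳ-≤ c (step c (n<1+n c))) (≤-reflexive (+-suc c _)))

  drift-≡ : (f : ℕ → ℕ) (c : ℕ) → (∀ m → m < c → f m ≡ suc (f (suc m))) → f 0 ≡ c + f c
  drift-≡ f zero    step = refl
  drift-≡ f (suc c) step = trans (drift-≡ f c λ m m<c → step m (m<n⇒m<1+n m<c))
    (trans (cong (c +_) (step c (n<1+n c))) (+-suc c _))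

open Telescoping

module DiagramFlags (M : Map) (D : Diagram M) where
  open Map M
  open Diagram D

  Flag : Set
  Flag = Fin n

  Crossing : Pred Flag 0ℓ
  Crossing x = cr x ≡ true

  σ : Flag → Flag
  σ x = τ₂ (τ₁ (τ₂ x))

  σ-involutive : ∀ x → σ (σ x) ≡ x
  σ-involutive x = trans (cong (τ₂ ∘ τ₁) (τ₂-invol _)) (trans (cong τ₂ (τ₁-invol _)) (τ₂-invol x))

  τ₁-swap : ∀ {x y} → τ₁ x ≡ y → x ≡ τ₁ y
  τ₁-swap {x} eq = trans (sym (τ₁-invol x)) (cong τ₁ eq)

  ρ²-on-crossing : ∀ {x} → Crossing x → ρ² M (ρ² M x) ≡ x
  ρ²-on-crossing {x} p = proj₁ (cr-deg4 x p)

  τ₁σ≡ρ² : ∀ {x} → Crossing x → τ₁ (σ x) ≡ ρ² M x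
  τ₁σ≡ρ² {x} p = trans (cong (τ₁ ∘ σ) (sym (ρ²-on-crossing p))) (unwind (ρ² M x))
    where
    unwind : ∀ y → τ₁ (σ (ρ² M y)) ≡ y
    unwind y = trans (cong (τ₁ ∘ τ₂ ∘ τ₁) (τ₂-invol _))
                 (trans (cong (τ₁ ∘ τ₂) (τ₁-invol _)) (trans (cong τ₁ (τ₂-invol _)) (τ₁-invol y)))

  τ₁ρ²≡σ : ∀ {x} → Crossing x → τ₁ (ρ² M x) ≡ σ x
  τ₁ρ²≡σ p = sym (τ₁-swap (τ₁σ≡ρ² p))

  ρ²τ₁≡σ : ∀ x → ρ² M (τ₁ x) ≡ σ x
  ρ²τ₁≡σ x = cong (τ₂ ∘ τ₁ ∘ τ₂) (τ₁-invol x)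

  ρ²τ₁≡τ₁ρ² : ∀ {x} → Crossing x → ρ² M (τ₁ x) ≡ τ₁ (ρ² M x)
  ρ²τ₁≡τ₁ρ² {x} p = trans (ρ²τ₁≡σ x) (sym (τ₁ρ²≡σ p))

  crossing-τ₁ : ∀ {x} → Crossing x → Crossing (τ₁ x)
  crossing-τ₁ {x} p = trans (cr-τ₁ x) p

  crossing-τ₂ : ∀ {x} → Crossing x → Crossing (τ₂ x)
  crossing-τ₂ {x} p = trans (cr-τ₂ x) p

  aPair-σ : ∀ {x} → Crossing x → aPair (σ x) ≡ aPair x
  aPair-σ {x} p = begin
    aPair (τ₂ (τ₁ (τ₂ x)))    ≡⟨ aPair-τ₂ _ (crossing-τ₁ (crossing-τ₂ p)) ⟩
    not (aPair (τ₁ (τ₂ x)))   ≡⟨ cong not (aPair-τ₁ _ (crossing-τ₂ p)) ⟩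
    not (aPair (τ₂ x))        ≡⟨ cong not (aPair-τ₂ x p) ⟩
    not (not (aPair x))       ≡⟨ Bool.not-involutive _ ⟩
    aPair x                   ∎
    where open ≡-Reasoning

  At : Rel Flag 0ℓ
  At = EqClosure (HatV M)

  at-τ₁ : ∀ {x} → At x (τ₁ x)
  at-τ₁ = EC.return (v₁ _)

  at-τ₂ : ∀ {x} → At x (τ₂ x)
  at-τ₂ = EC.return (v₂ _)

  at-σ : ∀ {x} → At x (σ x)
  at-σ = at-τ₂ ◅◅ at-τ₁ ◅◅ at-τ₂

  at-ρ² : ∀ {x} → At x (ρ² M x)
  at-ρ² = at-τ₁ ◅◅ at-τ₂ ◅◅ at-τ₁ ◅◅ at-τ₂

  cr-at : ∀ {x y} → At x y → cr x ≡ cr y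
  cr-at = EC.gfold isEquivalence cr λ { (v₁ f) → sym (cr-τ₁ f) ; (v₂ f) → sym (cr-τ₂ f) }

  crossing-at : ∀ {x y} → At x y → Crossing x → Crossing y
  crossing-at x~y = subst (_≡ true) (cr-at x~y)

  at-induction : ∀ {z} (P : Pred Flag 0ℓ) → P z →
    (∀ {x} → At z x → P x → P (τ₁ x)) → (∀ {x} → At z x → P x → P (τ₂ x)) →
    ∀ {x} → At z x → P x
  at-induction {z} P pz step₁ step₂ z~x = proj₂ (closure-preserves Q forward backward z~x (ε , pz))
    where
    Q : Pred Flag 0ℓ
    Q x = At z x × P x
    forward : ∀ {x y} → HatV M x y → Q x → Q y
    forward (v₁ x) (z~x , px) = z~x ◅◅ at-τ₁ , step₁ z~x px
    forward (v₂ x) (z~x , px) = z~x ◅◅ at-τ₂ , step₂ z~x px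
    backward : ∀ {x y} → HatV M x y → Q y → Q x
    backward (v₁ x) q = subst Q (τ₁-invol x) (forward (v₁ (τ₁ x)) q)
    backward (v₂ x) q = subst Q (τ₂-invol x) (forward (v₂ (τ₂ x)) q)

  SamePair : Flag → Pred Flag 0ℓ
  SamePair a x = At a x × aPair x ≡ aPair a

  samePair-refl : ∀ {a} → SamePair a a
  samePair-refl = ε , refl

  module _ {a : Flag} (a-cr : Crossing a) where

    samePair-τ₁ : ∀ {x} → SamePair a x → SamePair a (τ₁ x)
    samePair-τ₁ (a~x , same) = a~x ◅◅ at-τ₁ , trans (aPair-τ₁ _ (crossing-at a~x a-cr)) same

    samePair-σ : ∀ {x} → SamePair a x → SamePair a (σ x)
    samePair-σ (a~x , same) = a~x ◅◅ at-σ , trans (aPair-σ (crossing-at a~x a-cr)) same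

    samePair-flags : ∀ {x} → SamePair a x → x ≡ a ⊎ x ≡ τ₁ a ⊎ x ≡ ρ² M a ⊎ x ≡ σ a
    samePair-flags (a~x , same) = proj₁ (at-induction P base step₁ step₂ a~x) same
      where
      u = aPair a
      Four : Pred Flag 0ℓ
      Four x = x ≡ a ⊎ x ≡ τ₁ a ⊎ x ≡ ρ² M a ⊎ x ≡ σ a
      P : Pred Flag 0ℓ
      P x = (aPair x ≡ u → Four x) × (aPair x ≡ not u → Four (τ₂ x))
      four-τ₁ : ∀ {x} → Four x → Four (τ₁ x)
      four-τ₁ (inj₁ refl)                = inj₂ (inj₁ refl)
      four-τ₁ (inj₂ (inj₁ refl))         = inj₁ (τ₁-invol a)
      four-τ₁ (inj₂ (inj₂ (inj₁ refl)))  = inj₂ (inj₂ (inj₂ (τ₁ρ²≡σ a-cr)))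
      four-τ₁ (inj₂ (inj₂ (inj₂ refl)))  = inj₂ (inj₂ (inj₁ (τ₁σ≡ρ² a-cr)))
      four-σ : ∀ {x} → Four x → Four (σ x)
      four-σ (inj₁ refl)                = inj₂ (inj₂ (inj₂ refl))
      four-σ (inj₂ (inj₁ refl))         = inj₂ (inj₂ (inj₁ refl))
      four-σ (inj₂ (inj₂ (inj₁ refl)))  = inj₂ (inj₁ (σ-involutive (τ₁ a)))
      four-σ (inj₂ (inj₂ (inj₂ refl)))  = inj₁ (σ-involutive a)
      not-flip : ∀ {b c} → not b ≡ c → b ≡ not c
      not-flip {b} {c} eq = Bool.not-injective (trans eq (sym (Bool.not-involutive c)))
      base : P a
      base = (λ _ → inj₁ refl) , λ eq → contradiction eq (Bool.not-¬ refl)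
      step₁ : ∀ {x} → At a x → P x → P (τ₁ x)
      step₁ {x} a~x (f , g) =
        (λ eq → four-τ₁ (f (trans (sym (aPair-τ₁ x x-cr)) eq))) ,
        (λ eq → subst Four (cong (τ₂ ∘ τ₁) (τ₂-invol x)) (four-σ (g (trans (sym (aPair-τ₁ x x-cr)) eq))))
        where x-cr = crossing-at a~x a-cr
      step₂ : ∀ {x} → At a x → P x → P (τ₂ x)
      step₂ {x} a~x (f , g) =
        (λ eq → g (not-flip (trans (sym (aPair-τ₂ x x-cr)) eq))) ,
        (λ eq → subst Four (sym (τ₂-invol x)) (f (Bool.not-injective (trans (sym (aPair-τ₂ x x-cr)) eq))))
        where x-cr = crossing-at a~x a-cr

  -- Vertices and components of the diagram keeping exactly the corners {x, τ₁ x} with P x,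
  -- regions of F merged across the opposite corners of the flags in P, and vertices of G
  -- (whose strands run through crossings along ρ²) keeping the corners with P x.
  VertexRel : Pred Flag 0ℓ → Rel Flag 0ℓ
  VertexRel P = AlongAt P τ₁ ∪ʳ Along τ₂

  ComponentRel : Pred Flag 0ℓ → Rel Flag 0ℓ
  ComponentRel P = AlongAt P τ₁ ∪ʳ (Along τ₂ ∪ʳ Along τ₀)

  StrandRel : Pred Flag 0ℓ → Rel Flag 0ℓ
  StrandRel P = AlongAt P τ₁ ∪ʳ (Along τ₂ ∪ʳ AlongAt Crossing (ρ² M))

  RegionRel : Pred Flag 0ℓ → Rel Flag 0ℓ
  RegionRel P = AlongAt P (ρ² M) ∪ʳ (Along τ₀ ∪ʳ Along τ₁)

  infixr 5 _∪?_

  _∪?_ : ∀ {R S : Rel Flag 0ℓ} → Decidable R → Decidable S → Decidable (R ∪ʳ S)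
  (R? ∪? S?) x y = map′ Sum.[ inl , inr ]′ (λ { (inl r) → inj₁ r ; (inr s) → inj₂ s }) (R? x y ⊎-dec S? x y)

  Along? : ∀ (h : Flag → Flag) → Decidable (Along h)
  Along? h x y = y ≟ h x

  AlongAt? : ∀ {P : Pred Flag 0ℓ} → U.Decidable P → ∀ (h : Flag → Flag) → Decidable (AlongAt P h)
  AlongAt? P? h x y = P? x ×-dec (y ≟ h x)

  crossing? : U.Decidable Crossing
  crossing? x = cr x Bool.≟ true

  VertexRel? : ∀ {P : Pred Flag 0ℓ} → U.Decidable P → Decidable (VertexRel P)
  VertexRel? P? = AlongAt? P? τ₁ ∪? Along? τ₂

  ComponentRel? : ∀ {P : Pred Flag 0ℓ} → U.Decidable P → Decidable (ComponentRel P)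
  ComponentRel? P? = AlongAt? P? τ₁ ∪? Along? τ₂ ∪? Along? τ₀

  StrandRel? : ∀ {P : Pred Flag 0ℓ} → U.Decidable P → Decidable (StrandRel P)
  StrandRel? P? = AlongAt? P? τ₁ ∪? Along? τ₂ ∪? AlongAt? crossing? (ρ² M)

  RegionRel? : ∀ {P : Pred Flag 0ℓ} → U.Decidable P → Decidable (RegionRel P)
  RegionRel? P? = AlongAt? P? (ρ² M) ∪? Along? τ₀ ∪? Along? τ₁

  module _ {a : Flag} (a-cr : Crossing a) where

    arc-link : ∀ {R : Rel Flag 0ℓ} → (∀ x → EqClosure R x (τ₂ x)) →
      (∀ {x} → At a x → aPair x ≡ not (aPair a) → EqClosure R x (τ₁ x)) →
      ∀ {x} → SamePair a x → EqClosure (R ∪ʳ Link a (τ₁ a)) x (τ₁ x)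
    arc-link {R} side hug x∈ = from-flags (samePair-flags a-cr x∈)
      where
      R⁺ = R ∪ʳ Link a (τ₁ a)
      arc : ∀ {y} → SamePair a y → EqClosure R y (σ y)
      arc {y} (a~y , same) = side y ◅◅ hug (a~y ◅◅ at-τ₂) other ◅◅ side (τ₁ (τ₂ y))
        where other = trans (aPair-τ₂ y (crossing-at a~y a-cr)) (cong not same)
      across : EqClosure R⁺ (σ a) (ρ² M a)
      across = EC.symmetric _ (closure-⇒* ⇒*-∪ˡ (arc samePair-refl)) ◅◅ linked
               ◅◅ closure-⇒* ⇒*-∪ˡ (arc (samePair-τ₁ a-cr samePair-refl))
      from-flags : ∀ {x} → x ≡ a ⊎ x ≡ τ₁ a ⊎ x ≡ ρ² M a ⊎ x ≡ σ a → EqClosure R⁺ x (τ₁ x)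
      from-flags (inj₁ refl)               = linked
      from-flags (inj₂ (inj₁ refl))        = subst (EqClosure R⁺ (τ₁ a)) (sym (τ₁-invol a)) (EC.symmetric _ linked)
      from-flags (inj₂ (inj₂ (inj₁ refl))) = subst (EqClosure R⁺ (ρ² M a)) (sym (τ₁ρ²≡σ a-cr)) (EC.symmetric _ across)
      from-flags (inj₂ (inj₂ (inj₂ refl))) = subst (EqClosure R⁺ (σ a)) (sym (τ₁σ≡ρ² a-cr)) across

    band-link : ∀ {R : Rel Flag 0ℓ} → (∀ x → EqClosure R x (τ₁ x)) →
      ∀ {x} → SamePair a x → EqClosure (R ∪ʳ Link a (ρ² M a)) x (ρ² M x)
    band-link {R} corner x∈ = from-flags (samePair-flags a-cr x∈)
      where
      R⁺ = R ∪ʳ Link a (ρ² M a)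
      ρ²-crossing : Crossing (ρ² M a)
      ρ²-crossing = crossing-at at-ρ² a-cr
      opposite : EqClosure R⁺ (ρ² M a) (ρ² M (ρ² M a))
      opposite = subst (EqClosure R⁺ (ρ² M a)) (sym (ρ²-on-crossing a-cr)) (EC.symmetric _ linked)
      band-τ₁ : ∀ {y} → Crossing y → EqClosure R⁺ y (ρ² M y) → EqClosure R⁺ (τ₁ y) (ρ² M (τ₁ y))
      band-τ₁ {y} y-cr y~ρ²y = subst (EqClosure R⁺ (τ₁ y)) (sym (ρ²τ₁≡τ₁ρ² y-cr))
        (EC.symmetric _ (closure-⇒* ⇒*-∪ˡ (corner y)) ◅◅ y~ρ²y ◅◅ closure-⇒* ⇒*-∪ˡ (corner (ρ² M y)))
      from-flags : ∀ {x} → x ≡ a ⊎ x ≡ τ₁ a ⊎ x ≡ ρ² M a ⊎ x ≡ σ a → EqClosure R⁺ x (ρ² M x)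
      from-flags (inj₁ refl)               = linked
      from-flags (inj₂ (inj₁ refl))        = band-τ₁ a-cr linked
      from-flags (inj₂ (inj₂ (inj₁ refl))) = opposite
      from-flags (inj₂ (inj₂ (inj₂ refl))) =
        subst (λ y → EqClosure R⁺ y (ρ² M y)) (τ₁ρ²≡σ a-cr) (band-τ₁ ρ²-crossing opposite)

    strand-link : ∀ {R : Rel Flag 0ℓ} → (∀ x → EqClosure R x (τ₂ x)) → (∀ {x} → At a x → EqClosure R x (ρ² M x)) →
      ∀ {x} → At a x → EqClosure (R ∪ʳ Link a (τ₁ a)) x (τ₁ x)
    strand-link {R} side strand = at-induction (λ x → EqClosure R⁺ x (τ₁ x)) linked step₁ step₂
      where
      R⁺ = R ∪ʳ Link a (τ₁ a)
      step₁ : ∀ {x} → At a x → EqClosure R⁺ x (τ₁ x) → EqClosure R⁺ (τ₁ x) (τ₁ (τ₁ x))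
      step₁ {x} _ x~τ₁x = subst (EqClosure R⁺ (τ₁ x)) (sym (τ₁-invol x)) (EC.symmetric _ x~τ₁x)
      step₂ : ∀ {x} → At a x → EqClosure R⁺ x (τ₁ x) → EqClosure R⁺ (τ₂ x) (τ₁ (τ₂ x))
      step₂ {x} a~x x~τ₁x =
        EC.symmetric _ (closure-⇒* ⇒*-∪ˡ (side x)) ◅◅ x~τ₁x
        ◅◅ subst (EqClosure R⁺ (τ₁ x)) (ρ²τ₁≡σ x) (closure-⇒* ⇒*-∪ˡ (strand (a~x ◅◅ at-τ₁)))
        ◅◅ EC.symmetric _ (closure-⇒* ⇒*-∪ˡ (side (τ₁ (τ₂ x))))

    arc-separated : ∀ {P : Pred Flag 0ℓ} → (∀ {x} → SamePair a x → ¬ P x) → ¬ EqClosure (VertexRel P) a (τ₁ a)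
    arc-separated {P} unhugged a~τ₁a = off-arc (closure-preserves OnArc forward backward a~τ₁a (inj₁ refl))
      where
      OnArc : Pred Flag 0ℓ
      OnArc x = x ≡ a ⊎ x ≡ τ₂ a ⊎ x ≡ τ₁ (τ₂ a) ⊎ x ≡ σ a
      along-τ₂ : ∀ {x} → OnArc x → OnArc (τ₂ x)
      along-τ₂ (inj₁ refl)               = inj₂ (inj₁ refl)
      along-τ₂ (inj₂ (inj₁ refl))        = inj₁ (τ₂-invol a)
      along-τ₂ (inj₂ (inj₂ (inj₁ refl))) = inj₂ (inj₂ (inj₂ refl))
      along-τ₂ (inj₂ (inj₂ (inj₂ refl))) = inj₂ (inj₂ (inj₁ (τ₂-invol _)))
      forward : ∀ {x y} → VertexRel P x y → OnArc x → OnArc y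
      forward (inl (p , refl)) (inj₁ refl)               = contradiction p (unhugged samePair-refl)
      forward (inl (p , refl)) (inj₂ (inj₁ refl))        = inj₂ (inj₂ (inj₁ refl))
      forward (inl (p , refl)) (inj₂ (inj₂ (inj₁ refl))) = inj₂ (inj₁ (τ₁-invol _))
      forward (inl (p , refl)) (inj₂ (inj₂ (inj₂ refl))) = contradiction p (unhugged (samePair-σ a-cr samePair-refl))
      forward (inr refl) x∈ = along-τ₂ x∈
      backward : ∀ {x y} → VertexRel P x y → OnArc y → OnArc x
      backward (inl (p , refl)) (inj₁ eq)               =
        contradiction (subst P (τ₁-swap eq) p) (unhugged (samePair-τ₁ a-cr samePair-refl))
      backward (inl (p , refl)) (inj₂ (inj₁ eq))        = inj₂ (inj₂ (inj₁ (τ₁-swap eq)))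
      backward (inl (p , refl)) (inj₂ (inj₂ (inj₁ eq))) = inj₂ (inj₁ (trans (τ₁-swap eq) (τ₁-invol _)))
      backward (inl (p , refl)) (inj₂ (inj₂ (inj₂ eq))) =
        contradiction (subst P (trans (τ₁-swap eq) (τ₁σ≡ρ² a-cr)) p)
                      (unhugged (samePair-σ a-cr (samePair-τ₁ a-cr samePair-refl)))
      backward {x} (inr refl) y∈ = subst OnArc (τ₂-invol x) (along-τ₂ y∈)
      off-arc : ¬ OnArc (τ₁ a)
      off-arc (inj₁ eq) = τ₁-fpf a eq
      off-arc (inj₂ (inj₁ eq)) = Bool.not-¬ refl (trans (sym (aPair-τ₁ a a-cr)) (trans (cong aPair eq) (aPair-τ₂ a a-cr)))
      off-arc (inj₂ (inj₂ (inj₁ eq))) = τ₂-fpf a (sym (trans (τ₁-swap eq) (τ₁-invol _)))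
      off-arc (inj₂ (inj₂ (inj₂ eq))) = proj₂ (cr-deg4 a a-cr) (sym (trans (τ₁-swap eq) (τ₁σ≡ρ² a-cr)))

  module _ {P : Pred Flag 0ℓ} where

    VertexRel-all : (∀ x → P x) → VertexRel P ≈* HatV M
    VertexRel-all all =
      (λ { (inl (_ , refl)) → at-τ₁ ; (inr refl) → at-τ₂ }) ,
      (λ { (v₁ x) → EC.return (inl (all x , refl)) ; (v₂ x) → EC.return (inr refl) })

    StrandRel-all : (∀ x → P x) → StrandRel P ≈* HatV M
    StrandRel-all all =
      (λ { (inl (_ , refl)) → at-τ₁ ; (inr (inl refl)) → at-τ₂ ; (inr (inr (_ , refl))) → at-ρ² }) ,
      (λ { (v₁ x) → EC.return (inl (all x , refl)) ; (v₂ x) → EC.return (inr (inl refl)) })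

    ComponentRel-all-connected : (∀ x → P x) → HasClasses (ComponentRel P) 1
    ComponentRel-all-connected all = record
      { cls = λ _ → zero
      ; cls-surj = λ { zero → fromℕ< nonempty , refl }
      ; cls-resp = λ _ → refl
      ; cls-reflect = λ {x} {y} _ → closure-⇒* (EC.return ∘ move) (connected x y) }
      where
      move : ∀ {x y} → (y ≡ τ₀ x) ⊎ (y ≡ τ₁ x) ⊎ (y ≡ τ₂ x) → ComponentRel P x y
      move {x} (inj₁ eq)        = inr (inr eq)
      move {x} (inj₂ (inj₁ eq)) = inl (all x , eq)
      move {x} (inj₂ (inj₂ eq)) = inr (inl eq)

    RegionRel-none : (∀ x → ¬ P x) → RegionRel P ≈* HatF M
    RegionRel-none none =
      (λ { (inl (p , _)) → contradiction p (none _) ; (inr (inl refl)) → EC.return (f₀ _) ; (inr (inr refl)) → EC.return (f₁ _) }) ,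
      (λ { (f₀ x) → EC.return (inr (inl refl)) ; (f₁ x) → EC.return (inr (inr refl)) })

    RegionRel-crossings : P U.⊆ Crossing → Crossing U.⊆ P → RegionRel P ≈* (HatF M ∪ʳ DualE M D)
    RegionRel-crossings P⊆cr cr⊆P =
      (λ { (inl (p , refl)) → EC.return (inr (de _ (P⊆cr p)))
         ; (inr (inl refl)) → EC.return (inl (f₀ _)) ; (inr (inr refl)) → EC.return (inl (f₁ _)) }) ,
      (λ { (inl (f₀ x)) → EC.return (inr (inl refl)) ; (inl (f₁ x)) → EC.return (inr (inr refl))
         ; (inr (de x p)) → EC.return (inl (cr⊆P p , refl)) })

    RegionRel-mono : ∀ {Q : Pred Flag 0ℓ} → P U.⊆ Q → RegionRel P ⇒* RegionRel Q
    RegionRel-mono P⊆Q (inl (p , refl)) = EC.return (inl (P⊆Q p , refl))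
    RegionRel-mono P⊆Q (inr r)          = EC.return (inr r)

    module _ {t : Bool} (P⇒t : ∀ {x} → P x → Crossing x → aPair x ≡ t) (t⇒P : ∀ {x} → (Crossing x → aPair x ≡ t) → P x) where

      private
        smoothed-corner : ∀ {x} → P x → SV M D t x (τ₁ x)
        smoothed-corner {x} p with cr x in eq
        ... | true  = svc x eq (P⇒t p eq)
        ... | false = sv₁ x eq

        unsmoothed : ∀ {x} → cr x ≡ false → P x
        unsmoothed eq = t⇒P λ eq′ → contradiction (trans (sym eq) eq′) λ ()

      VertexRel-smoothing : VertexRel P ≈* SV M D t
      VertexRel-smoothing =
        (λ { (inl (p , refl)) → EC.return (smoothed-corner p) ; (inr refl) → EC.return (sv₂ _) }) ,
        (λ { (sv₁ x eq) → EC.return (inl (unsmoothed eq , refl)) ; (sv₂ x) → EC.return (inr refl)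
           ; (svc x _ e) → EC.return (inl (t⇒P (λ _ → e) , refl)) })

      ComponentRel-smoothing : ComponentRel P ≈* (SV M D t ∪ʳ HatE M)
      ComponentRel-smoothing =
        (λ { (inl (p , refl)) → EC.return (inl (smoothed-corner p)) ; (inr (inl refl)) → EC.return (inl (sv₂ _))
           ; (inr (inr refl)) → EC.return (inr (e₀ _)) }) ,
        (λ { (inl (sv₁ x eq)) → EC.return (inl (unsmoothed eq , refl)) ; (inl (sv₂ x)) → EC.return (inr (inl refl))
           ; (inl (svc x _ e)) → EC.return (inl (t⇒P (λ _ → e) , refl))
           ; (inr (e₀ x)) → EC.return (inr (inr refl)) ; (inr (e₂ x)) → EC.return (inr (inl refl)) })

    StrandRel-spatial : P U.⊆ U.∁ Crossing → U.∁ Crossing U.⊆ P → StrandRel P ≈* GV M D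
    StrandRel-spatial P⊆∁cr ∁cr⊆P =
      (λ { (inl (p , refl)) → EC.return (gv₁ _ (Bool.¬-not (P⊆∁cr p)))
         ; (inr (inl refl)) → EC.return (gv₂ _) ; (inr (inr (p , refl))) → EC.return (gvs _ p) }) ,
      (λ { (gv₁ x eq) → EC.return (inl (∁cr⊆P (λ eq′ → contradiction (trans (sym eq) eq′) λ ()) , refl))
         ; (gv₂ x) → EC.return (inr (inl refl)) ; (gvs x p) → EC.return (inr (inr (p , refl))) })

  #vertices #components #regions #strands : ∀ {P : Pred Flag 0ℓ} → U.Decidable P → ℕ
  #vertices P?   = #classes (VertexRel? P?)
  #components P? = #classes (ComponentRel? P?)
  #regions P?    = #classes (RegionRel? P?)
  #strands P?    = #classes (StrandRel? P?)

module Restoring (M : Map) (D : Diagram M) {c : ℕ} (crossings : CrossingNumber M D c) where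
  open import Data.Nat using (_+_; _≤_; _<_)
  open import Data.Nat.Properties using (_<?_; <-irrefl; ≤-refl; ≤-trans; ≤-reflexive; +-monoʳ-≤; +-suc; +-assoc; n<1+n; m<n⇒m<1+n; m<1+n⇒m<n∨m≡n; module ≤-Reasoning)
  open import Data.Nat.Divisibility using (_∣_; ∣m∣n⇒∣m+n)
  open Map M
  open Diagram D
  open DiagramFlags M D
  private module C = HasClassesProperties crossings

  -- the value c at flags off the crossings is never used
  index : (x : Flag) (b : Bool) → cr x ≡ b → ℕ
  index x true  p = toℕ (C.cls (x , p))
  index x false _ = c

  ix : Flag → ℕ
  ix x = index x (cr x) refl

  ix-crossing : ∀ {x} (p : Crossing x) → ix x ≡ toℕ (C.cls (x , p))
  ix-crossing {x} p = at (cr x) refl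
    where
    at : ∀ b (q : cr x ≡ b) → index x b q ≡ toℕ (C.cls (x , p))
    at true  q = cong (λ q → toℕ (C.cls (x , q))) (Decidable⇒UIP.≡-irrelevant Bool._≟_ q p)
    at false q = contradiction (trans (sym q) p) λ ()

  ix-off : ∀ {x} → cr x ≡ false → ix x ≡ c
  ix-off {x} p = at (cr x) refl
    where
    at : ∀ b (q : cr x ≡ b) → index x b q ≡ c
    at true  q = contradiction (trans (sym q) p) λ ()
    at false q = refl

  ix<c : ∀ {x} → Crossing x → ix x < c
  ix<c p = subst (_< c) (sym (ix-crossing p)) (toℕ<n _)

  ix-at : ∀ {x y} → At x y → ix x ≡ ix y
  ix-at = EC.gfold isEquivalence ix step
    where
    step : ∀ {x y} → HatV M x y → ix x ≡ ix y
    step {x} {y} x~y = by-cr (cr x) refl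
      where
      by-cr : ∀ b → cr x ≡ b → ix x ≡ ix y
      by-cr true  p = trans (ix-crossing p) (trans (cong toℕ (C.cls-resp {x , p} {y , q} x~y)) (sym (ix-crossing q)))
        where q = crossing-at (EC.return x~y) p
      by-cr false p = trans (ix-off p) (sym (ix-off (trans (sym (cr-at (EC.return x~y))) p)))

  at-same-index : ∀ {x y} → Crossing x → Crossing y → ix x ≡ ix y → At x y
  at-same-index p q eq = EC.gmap proj₁ id
    (C.cls-reflect (toℕ-injective (trans (sym (ix-crossing p)) (trans eq (ix-crossing q)))))

  -- At stage m the crossings of index < m are restored and the others smoothed: the corner
  -- {x, τ₁ x} is kept when Hugs t m x, and regions are merged across the other corners.
  -- Joined m is the same for G; TrueOrRestored and FalseAndRestored interpolate between the
  -- merged regions of the two states and those of the dual graph.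
  Restored : ℕ → Pred Flag 0ℓ
  Restored m x = ix x < m

  Hugs : Bool → ℕ → Pred Flag 0ℓ
  Hugs t m x = Crossing x → aPair x ≡ t ⊎ Restored m x

  Joined : ℕ → Pred Flag 0ℓ
  Joined m x = Crossing x → Restored m x

  TrueOrRestored FalseAndRestored : ℕ → Pred Flag 0ℓ
  TrueOrRestored m x   = Crossing x × (aPair x ≡ true ⊎ Restored m x)
  FalseAndRestored m x = Crossing x × (aPair x ≡ false × Restored m x)

  Hugs? : ∀ t m → U.Decidable (Hugs t m)
  Hugs? t m x = crossing? x →-dec ((aPair x Bool.≟ t) ⊎-dec (ix x <? m))

  Joined? : ∀ m → U.Decidable (Joined m)
  Joined? m x = crossing? x →-dec (ix x <? m)

  TrueOrRestored? : ∀ m → U.Decidable (TrueOrRestored m)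
  TrueOrRestored? m x = crossing? x ×-dec ((aPair x Bool.≟ true) ⊎-dec (ix x <? m))

  FalseAndRestored? : ∀ m → U.Decidable (FalseAndRestored m)
  FalseAndRestored? m x = crossing? x ×-dec ((aPair x Bool.≟ false) ×-dec (ix x <? m))

  module _ {t : Bool} {m : ℕ} where

    hugs-mono : Hugs t m U.⊆ Hugs t (suc m)
    hugs-mono h p = Sum.map₂ m<n⇒m<1+n (h p)

    unhugged : ∀ {x} → ¬ Hugs t m x → Crossing x × aPair x ≡ not t × ¬ Restored m x
    unhugged {x} ¬h with crossing? x
    ... | yes p = p , Bool.¬-not (λ e → ¬h λ _ → inj₁ e) , (λ lt → ¬h λ _ → inj₂ lt)
    ... | no ¬p = contradiction (λ p → contradiction p ¬p) ¬h

    hugs-transport : ∀ {x y} → At x y → (Crossing x → aPair y ≡ aPair x) → Hugs t m x → Hugs t m y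
    hugs-transport x~y same h q =
      Sum.map (trans (same p)) (subst (_< m) (ix-at x~y)) (h p)
      where p = crossing-at (EC.symmetric _ x~y) q

    hugs-τ₁ : ∀ {x} → Hugs t m x → Hugs t m (τ₁ x)
    hugs-τ₁ {x} = hugs-transport at-τ₁ (aPair-τ₁ x)

    hugs-σ : ∀ {x} → Hugs t m x → Hugs t m (σ x)
    hugs-σ = hugs-transport at-σ aPair-σ

  module AtCrossing (m : ℕ) (m<c : m < c) where

    private
      j = fromℕ< m<c

    r : Flag
    r = proj₁ (C.rep j)

    r-cr : Crossing r
    r-cr = proj₂ (C.rep j)

    ix-r : ix r ≡ m
    ix-r = trans (ix-crossing r-cr) (trans (cong toℕ (C.cls-rep j)) (toℕ-fromℕ< m<c))

    at-r : ∀ {x} → Crossing x → ix x ≡ m → At r x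
    at-r p eq = at-same-index r-cr p (trans ix-r (sym eq))

    restored-suc : ∀ {x} → Restored (suc m) x → Restored m x ⊎ ix x ≡ m
    restored-suc = m<1+n⇒m<n∨m≡n

    pairFlag : (u : Bool) → Σ[ a ∈ Flag ] At r a × aPair a ≡ u
    pairFlag u with aPair r Bool.≟ u
    ... | yes eq  = r , ε , eq
    ... | no  neq = τ₂ r , at-τ₂ , trans (aPair-τ₂ r r-cr) (sym (Bool.¬-not (neq ∘ sym)))

    module PairAt (u : Bool) where

      a : Flag
      a = proj₁ (pairFlag u)

      r~a : At r a
      r~a = proj₁ (proj₂ (pairFlag u))

      a-type : aPair a ≡ u
      a-type = proj₂ (proj₂ (pairFlag u))

      a-cr : Crossing a
      a-cr = crossing-at r~a r-cr

      samePair-intro : ∀ {x} → Crossing x → ix x ≡ m → aPair x ≡ u → SamePair a x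
      samePair-intro p eq type = EC.symmetric _ r~a ◅◅ at-r p eq , trans type (sym a-type)

      samePair-crossing : ∀ {x} → SamePair a x → Crossing x
      samePair-crossing (a~x , _) = crossing-at a~x a-cr

      samePair-ix : ∀ {x} → SamePair a x → ix x ≡ m
      samePair-ix (a~x , _) = trans (sym (ix-at (r~a ◅◅ a~x))) ix-r

      samePair-restored : ∀ {x} → SamePair a x → Restored (suc m) x
      samePair-restored x∈ = subst (_< suc m) (sym (samePair-ix x∈)) (n<1+n m)

    module Smoothing (t : Bool) where
      open PairAt (not t)

      hugged-after : ∀ {x} → SamePair a x → Hugs t (suc m) x
      hugged-after x∈ _ = inj₂ (samePair-restored x∈)

      unhugged-before : ∀ {x} → SamePair a x → ¬ Hugs t m x
      unhugged-before x∈ h with h (samePair-crossing x∈)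
      ... | inj₁ e  = Bool.not-¬ e (trans (proj₂ x∈) a-type)
      ... | inj₂ lt = <-irrefl (samePair-ix x∈) lt

      hugs-step : Hugs t (suc m) U.⊆ Hugs t m U.∪ SamePair a
      hugs-step {x} h with Hugs? t m x
      ... | yes h′ = inj₁ h′
      ... | no ¬h with unhugged ¬h
      ...   | p , type , ¬restored with h p
      ...     | inj₁ e  = contradiction type (Bool.not-¬ e)
      ...     | inj₂ lt with restored-suc lt
      ...       | inj₁ lt′ = contradiction lt′ ¬restored
      ...       | inj₂ eq  = inj₂ (samePair-intro p eq type)

      cut-step : U.∁ (Hugs t m) U.⊆ U.∁ (Hugs t (suc m)) U.∪ SamePair a
      cut-step {x} ¬h with Hugs? t (suc m) x
      ... | no ¬h′ = inj₁ ¬h′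
      ... | yes h′ = Sum.[ (λ h → contradiction h ¬h) , inj₂ ]′ (hugs-step h′)

      hug-other : ∀ {x} → At a x → aPair x ≡ not (aPair a) → Hugs t m x
      hug-other _ e _ = inj₁ (trans e (trans (cong not a-type) (Bool.not-involutive t)))

      vertices-link : VertexRel (Hugs t (suc m)) ≈* (VertexRel (Hugs t m) ∪ʳ Link a (τ₁ a))
      vertices-link = guarded-step hugs-mono hugs-step (hugged-after samePair-refl)
        (arc-link a-cr (λ _ → EC.return (inr refl)) λ a~x e → EC.return (inl (hug-other a~x e , refl)))

      components-link : ComponentRel (Hugs t (suc m)) ≈* (ComponentRel (Hugs t m) ∪ʳ Link a (τ₁ a))
      components-link = guarded-step hugs-mono hugs-step (hugged-after samePair-refl)
        (arc-link a-cr (λ _ → EC.return (inr (inl refl))) λ a~x e → EC.return (inl (hug-other a~x e , refl)))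

      regions-link : RegionRel (U.∁ (Hugs t m)) ≈* (RegionRel (U.∁ (Hugs t (suc m))) ∪ʳ Link a (ρ² M a))
      regions-link = guarded-step (λ ¬h → ¬h ∘ hugs-mono) cut-step (unhugged-before samePair-refl)
        (band-link a-cr λ _ → EC.return (inr (inr refl)))

      vertices-step : #vertices (Hugs? t m) ≡ suc (#vertices (Hugs? t (suc m)))
      vertices-step = classes-link-across (#classes-correct (VertexRel? (Hugs? t m)))
        (HasClasses-≈* vertices-link (#classes-correct (VertexRel? (Hugs? t (suc m)))))
        (arc-separated a-cr unhugged-before)

      private
        K = ComponentRel (Hugs t m)
        R = RegionRel (U.∁ (Hugs t (suc m)))
        module K = HasClassesProperties (#classes-correct (ComponentRel? (Hugs? t m)))
        module R = HasClassesProperties (#classes-correct (RegionRel? (∁? (Hugs? t (suc m)))))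
        Kₘ = #classes-correct (ComponentRel? (Hugs? t m))
        Kₘ₊₁ = HasClasses-≈* components-link (#classes-correct (ComponentRel? (Hugs? t (suc m))))
        Rₘ₊₁ = #classes-correct (RegionRel? (∁? (Hugs? t (suc m))))
        Rₘ = HasClasses-≈* regions-link (#classes-correct (RegionRel? (∁? (Hugs? t m))))

      -- The flags Inside are paired off by τ₂ or τ₀, so there are evenly many of them;
      -- but ι pairs off all of them except a.
      module BothSeparated (a≁τ₁a : ¬ EqClosure K a (τ₁ a)) (a≁ρ²a : ¬ EqClosure R a (ρ² M a)) where

        Inside : Pred Flag 0ℓ
        Inside x = EqClosure K a x × EqClosure R a x

        Inside? : U.Decidable Inside
        Inside? x = K.related? a x ×-dec R.related? a x

        TwinInside : Pred Flag 0ℓ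
        TwinInside x = EqClosure R a (τ₂ x)

        twin-pairs : FreeInvolution (Inside ∩ TwinInside) τ₂
        twin-pairs = record
          { closed = λ {x} ((a~x , a≈x) , a≈τ₂x) →
              (a~x ◅◅ EC.return (inr (inl refl)) , a≈τ₂x) , subst (EqClosure R a) (sym (τ₂-invol x)) a≈x
          ; involutive = λ _ → τ₂-invol _
          ; fixed-point-free = λ _ → τ₂-fpf _ }

        edge-pairs : FreeInvolution (Inside ∩ ∁ TwinInside) τ₀
        edge-pairs = record
          { closed = λ {x} ((a~x , a≈x) , a≉τ₂x) →
              (a~x ◅◅ EC.return (inr (inr refl)) , a≈x ◅◅ EC.return (inr (inl refl))) ,
              λ a≈τ₂τ₀x → a≉τ₂x (subst (EqClosure R a) (sym (τ₀τ₂-comm x)) a≈τ₂τ₀x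
                                 ◅◅ EC.symmetric _ (EC.return (inr (inl refl))))
          ; involutive = λ _ → τ₀-invol _
          ; fixed-point-free = λ _ → τ₀-fpf _ }

        inside-even : 2 ∣ count Inside?
        inside-even = subst (2 ∣_) (sym (count-split Inside? (λ x → R.related? a (τ₂ x))))
          (∣m∣n⇒∣m+n (count-even _ twin-pairs) (count-even _ edge-pairs))

        ι : Flag → Flag
        ι x with Hugs? t m x
        ... | yes _ = τ₁ x
        ... | no _  = σ x

        ι-hugged : ∀ {x} → Hugs t m x → ι x ≡ τ₁ x
        ι-hugged {x} h with Hugs? t m x
        ... | yes _ = refl
        ... | no ¬h = contradiction h ¬h

        ι-cut : ∀ {x} → ¬ Hugs t m x → ι x ≡ σ x
        ι-cut {x} ¬h with Hugs? t m x
        ... | yes h = contradiction h ¬h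
        ... | no _  = refl

        ι-involutive : ∀ x → ι (ι x) ≡ x
        ι-involutive x with Hugs? t m x
        ... | yes h = trans (ι-hugged (hugs-τ₁ h)) (τ₁-invol x)
        ... | no ¬h = trans (ι-cut (¬h ∘ subst (Hugs t m) (σ-involutive x) ∘ hugs-σ)) (σ-involutive x)

        ι-fixed-point-free : ∀ x → ι x ≢ x
        ι-fixed-point-free x with Hugs? t m x
        ... | yes _ = τ₁-fpf x
        ... | no _  = λ σx≡x → τ₁-fpf (τ₂ x) (trans (sym (τ₂-invol _)) (cong τ₂ σx≡x))

        ι-closed : ∀ {x} → (Inside ∩ ∁ (_≡ a)) x → (Inside ∩ ∁ (_≡ a)) (ι x)
        ι-closed {x} ((a~x , a≈x) , x≢a) with Hugs? t m x
        ... | yes h =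
            ( (a~x ◅◅ EC.return (inl (h , refl)) , a≈x ◅◅ EC.return (inr (inr refl)))
            , λ τ₁x≡a → unhugged-before samePair-refl (subst (Hugs t m) τ₁x≡a (hugs-τ₁ h)) )
        ... | no ¬h with unhugged ¬h | Hugs? t (suc m) x
        ...   | _ | yes h′ = ⊥-elim (Sum.[ ¬h , in-pair ]′ (hugs-step h′))
          where
          in-pair : SamePair a x → ⊥
          in-pair x∈ with samePair-flags a-cr x∈
          ... | inj₁ x≡a                = x≢a x≡a
          ... | inj₂ (inj₁ refl)        = a≁τ₁a a~x
          ... | inj₂ (inj₂ (inj₁ refl)) = a≁ρ²a a≈x
          ... | inj₂ (inj₂ (inj₂ refl)) = a≁ρ²a (subst (EqClosure R a) (τ₁σ≡ρ² a-cr) (a≈x ◅◅ EC.return (inr (inr refl))))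
        ...   | p , type , _ | no ¬h′ =
            ( (a~x ◅◅ EC.return (inr (inl refl)) ◅◅ EC.return (inl (other , refl)) ◅◅ EC.return (inr (inl refl))
              , subst (EqClosure R a) (τ₁ρ²≡σ p) (a≈x ◅◅ EC.return (inl (¬h′ , refl)) ◅◅ EC.return (inr (inr refl))))
            , λ σx≡a → ¬h′ (subst (Hugs t (suc m)) (trans (cong σ (sym σx≡a)) (σ-involutive x))
                                 (hugged-after (samePair-σ a-cr samePair-refl))) )
          where
          other : Hugs t m (τ₂ x)
          other _ = inj₁ (trans (aPair-τ₂ x p) (trans (cong not type) (Bool.not-involutive t)))

        cut-pairs : FreeInvolution (Inside ∩ ∁ (_≡ a)) ι
        cut-pairs = record
          { closed = ι-closed ; involutive = λ _ → ι-involutive _ ; fixed-point-free = λ _ → ι-fixed-point-free _ }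

        absurd : ⊥
        absurd = odd-not-even (count-even _ cut-pairs) (subst (2 ∣_) (count-remove Inside? (ε , ε)) inside-even)

      cut⇒joined : ¬ EqClosure K a (τ₁ a) → EqClosure R a (ρ² M a)
      cut⇒joined a≁τ₁a with R.related? a (ρ² M a)
      ... | yes a≈ρ²a = a≈ρ²a
      ... | no a≁ρ²a  = ⊥-elim (BothSeparated.absurd a≁τ₁a a≁ρ²a)

      components-regions-step :
        #components (Hugs? t m) + #regions (∁? (Hugs? t (suc m))) ≤ suc (#components (Hugs? t (suc m))) + #regions (∁? (Hugs? t m))
      components-regions-step with K.related? a (τ₁ a)
      ... | yes a~τ₁a rewrite classes-link-within Kₘ Kₘ₊₁ a~τ₁a =
        ≤-trans (+-monoʳ-≤ _ (classes-link-≤ Rₘ₊₁ Rₘ)) (≤-reflexive (+-suc _ _))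
      ... | no a≁τ₁a rewrite classes-link-across Kₘ Kₘ₊₁ a≁τ₁a | classes-link-within Rₘ₊₁ Rₘ (cut⇒joined a≁τ₁a) = ≤-refl

    joined-step : Joined (suc m) U.⊆ Joined m U.∪ At r
    joined-step {x} j with crossing? x
    ... | no ¬p = inj₁ λ p → contradiction p ¬p
    ... | yes p = Sum.map (λ lt _ → lt) (at-r p) (restored-suc (j p))

    strands-step : #strands (Joined? m) ≤ suc (#strands (Joined? (suc m)))
    strands-step = classes-link-≤ (#classes-correct (StrandRel? (Joined? m)))
      (HasClasses-≈* strands-link (#classes-correct (StrandRel? (Joined? (suc m)))))
      where
      strands-link : StrandRel (Joined (suc m)) ≈* (StrandRel (Joined m) ∪ʳ Link r (τ₁ r))
      strands-link = guarded-step (λ j p → m<n⇒m<1+n (j p)) joined-step (λ _ → subst (_< suc m) (sym ix-r) (n<1+n m))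
        (strand-link r-cr (λ _ → EC.return (inr (inl refl))) λ r~x → EC.return (inr (inr (crossing-at r~x r-cr , refl))))

    dual-step : #regions (TrueOrRestored? m) + #regions (FalseAndRestored? (suc m))
              ≤ #regions (TrueOrRestored? (suc m)) + #regions (FalseAndRestored? m)
    dual-step = classes-link-submodular (RegionRel-mono λ (p , _ , lt) → p , inj₂ lt)
      (#classes-correct (RegionRel? (FalseAndRestored? m)))
      (HasClasses-≈* false-link (#classes-correct (RegionRel? (FalseAndRestored? (suc m)))))
      (#classes-correct (RegionRel? (TrueOrRestored? m)))
      (HasClasses-≈* true-link (#classes-correct (RegionRel? (TrueOrRestored? (suc m)))))
      where
      open PairAt false
      band : ∀ {P} → ∀ {x} → SamePair a x → EqClosure (RegionRel P ∪ʳ Link a (ρ² M a)) x (ρ² M x)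
      band = band-link a-cr λ _ → EC.return (inr (inr refl))
      a-restored : Restored (suc m) a
      a-restored = samePair-restored samePair-refl
      true-link : RegionRel (TrueOrRestored (suc m)) ≈* (RegionRel (TrueOrRestored m) ∪ʳ Link a (ρ² M a))
      true-link = guarded-step (Product.map₂ (Sum.map₂ m<n⇒m<1+n)) step (a-cr , inj₂ a-restored) band
        where
        step : TrueOrRestored (suc m) U.⊆ TrueOrRestored m U.∪ SamePair a
        step {x} (p , inj₁ e)  = inj₁ (p , inj₁ e)
        step {x} (p , inj₂ lt) with restored-suc lt | aPair x Bool.≟ true
        ... | inj₁ lt′ | _      = inj₁ (p , inj₂ lt′)
        ... | inj₂ _   | yes e  = inj₁ (p , inj₁ e)
        ... | inj₂ eq  | no ¬e  = inj₂ (samePair-intro p eq (Bool.¬-not ¬e))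
      false-link : RegionRel (FalseAndRestored (suc m)) ≈* (RegionRel (FalseAndRestored m) ∪ʳ Link a (ρ² M a))
      false-link = guarded-step (λ (p , e , lt) → p , e , m<n⇒m<1+n lt) step (a-cr , a-type , a-restored) band
        where
        step : FalseAndRestored (suc m) U.⊆ FalseAndRestored m U.∪ SamePair a
        step (p , e , lt) = Sum.map (λ lt′ → p , e , lt′) (λ eq → samePair-intro p eq e) (restored-suc lt)

  private
    never-restored : ∀ {x} → ¬ Restored 0 x
    never-restored ()

    all-restored : ∀ {x} → Crossing x → Restored c x
    all-restored = ix<c

  module _ (t : Bool) where

    all-hugged : ∀ x → Hugs t c x
    all-hugged x = inj₂ ∘ all-restored

    private
      smoothed : ∀ {x} → Hugs t 0 x → Crossing x → aPair x ≡ t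
      smoothed h p = Sum.[ id , (λ lt → contradiction lt never-restored) ]′ (h p)

    vertices-smoothing : ∀ {k v′} → HasClasses (SV M D t) k → HasClasses (HatV M) v′ → k ≡ c + v′
    vertices-smoothing {k} {v′} S V = begin
      k                          ≡⟨ sym (#classes-≈* (VertexRel-smoothing smoothed (λ f → inj₁ ∘ f)) _ S) ⟩
      #vertices (Hugs? t 0)      ≡⟨ drift-≡ (λ m → #vertices (Hugs? t m)) c (λ m m<c → AtCrossing.Smoothing.vertices-step m m<c t) ⟩
      c + #vertices (Hugs? t c)  ≡⟨ cong (c +_) (#classes-≈* (VertexRel-all all-hugged) _ V) ⟩
      c + v′                     ∎
      where open ≡-Reasoning

    components-smoothing : ∀ {k fc} → HasClasses (SV M D t ∪ʳ HatE M) k → HasClasses (HatF M) fc →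
      k + fc ≤ c + 1 + #regions (∁? (Hugs? t 0))
    components-smoothing {k} {fc} S F = begin
      k + fc                                        ≡⟨ cong₂ _+_ (sym (#classes-≈* (ComponentRel-smoothing smoothed (λ f → inj₁ ∘ f)) _ S))
                                                                   (sym (#classes-≈* (RegionRel-none λ x ¬h → ¬h (all-hugged x)) _ F)) ⟩
      (0 + #components (Hugs? t 0)) + #regions (∁? (Hugs? t c))
        ≤⟨ telescope (λ m → m + #components (Hugs? t m)) (λ m → #regions (∁? (Hugs? t m))) c step ⟩
      (c + #components (Hugs? t c)) + #regions (∁? (Hugs? t 0))
        ≡⟨ cong (λ k → c + k + #regions (∁? (Hugs? t 0))) (classes-unique (#classes-correct (ComponentRel? (Hugs? t c))) (ComponentRel-all-connected all-hugged)) ⟩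
      c + 1 + #regions (∁? (Hugs? t 0)) ∎
      where
      open ≤-Reasoning
      step : ∀ m → m < c → m + #components (Hugs? t m) + #regions (∁? (Hugs? t (suc m)))
                         ≤ suc m + #components (Hugs? t (suc m)) + #regions (∁? (Hugs? t m))
      step m m<c = begin
        m + K + R′          ≡⟨ +-assoc m K R′ ⟩
        m + (K + R′)        ≤⟨ +-monoʳ-≤ m (AtCrossing.Smoothing.components-regions-step m m<c t) ⟩
        m + (suc K′ + R)    ≡⟨ sym (+-assoc m (suc K′) R) ⟩
        m + suc K′ + R      ≡⟨ cong (_+ R) (+-suc m K′) ⟩
        suc m + K′ + R      ∎
        where
        K = #components (Hugs? t m)
        K′ = #components (Hugs? t (suc m))
        R = #regions (∁? (Hugs? t m))
        R′ = #regions (∁? (Hugs? t (suc m)))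

  regions-smoothings : ∀ {s fc} → HasClasses (HatF M ∪ʳ DualE M D) s → HasClasses (HatF M) fc →
    #regions (∁? (Hugs? false 0)) + #regions (∁? (Hugs? true 0)) ≤ s + fc
  regions-smoothings {s} {fc} S F = begin
    #regions (∁? (Hugs? false 0)) + #regions (∁? (Hugs? true 0))
      ≡⟨ cong₂ _+_ (#classes-≈* (RegionRel-mono A-corners , RegionRel-mono A-corners⁻¹) _ (#classes-correct (RegionRel? (TrueOrRestored? 0))))
                   (#classes-≈* (RegionRel-mono B-corners , RegionRel-mono B-corners⁻¹) _ (#classes-correct (RegionRel? (FalseAndRestored? c)))) ⟩
    #regions (TrueOrRestored? 0) + #regions (FalseAndRestored? c)
      ≤⟨ telescope (λ m → #regions (TrueOrRestored? m)) (λ m → #regions (FalseAndRestored? m)) c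
                   (λ m m<c → AtCrossing.dual-step m m<c) ⟩
    #regions (TrueOrRestored? c) + #regions (FalseAndRestored? 0)
      ≡⟨ cong₂ _+_ (#classes-≈* (RegionRel-crossings proj₁ λ p → p , inj₂ (all-restored p)) _ S)
                   (#classes-≈* (RegionRel-none λ x (_ , _ , lt) → never-restored lt) _ F) ⟩
    s + fc ∎
    where
    open ≤-Reasoning
    cut-type : ∀ {t x} → ¬ Hugs t 0 x → Crossing x × aPair x ≡ not t
    cut-type ¬h = let p , type , _ = unhugged ¬h in p , type
    A-corners : U.∁ (Hugs false 0) U.⊆ TrueOrRestored 0
    A-corners ¬h = let p , type = cut-type ¬h in p , inj₁ type
    A-corners⁻¹ : TrueOrRestored 0 U.⊆ U.∁ (Hugs false 0)
    A-corners⁻¹ (p , inj₁ e) h = Sum.[ (λ e′ → Bool.not-¬ e′ e) , never-restored ]′ (h p)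
    B-corners : U.∁ (Hugs true 0) U.⊆ FalseAndRestored c
    B-corners ¬h = let p , type = cut-type ¬h in p , type , all-restored p
    B-corners⁻¹ : FalseAndRestored c U.⊆ U.∁ (Hugs true 0)
    B-corners⁻¹ (p , e , _) h = Sum.[ (λ e′ → Bool.not-¬ e′ e) , never-restored ]′ (h p)

  spatial-vertices : ∀ {v v′} → HasClasses (GV M D) v → HasClasses (HatV M) v′ → v ≤ c + v′
  spatial-vertices {v} {v′} G V = begin
    v                      ≡⟨ sym (#classes-≈* (StrandRel-spatial (λ j p → never-restored (j p)) (λ ¬p p → contradiction p ¬p)) _ G) ⟩
    #strands (Joined? 0)   ≤⟨ drift-≤ (λ m → #strands (Joined? m)) c (λ m m<c → AtCrossing.strands-step m m<c) ⟩
    c + #strands (Joined? c) ≡⟨ cong (c +_) (#classes-≈* (StrandRel-all λ _ → all-restored) _ V) ⟩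
    c + v′ ∎
    where open ≤-Reasoning

import Data.Nat as ℕ
open import Data.Integer using (ℤ; +_; _-_; _+_; _≤_; +≤+; 0ℤ)
open import Data.Integer.Properties using (pos-+; +-mono-≤; +-monoʳ-≤; i≤j⇒0≤j-i; ≤-reflexive; ≤-trans; +-identityʳ)
open import Data.Integer.Tactic.RingSolver using (solve-∀)

private
  slack : ∀ {i j : ℕ} {x y : ℤ} → i ℕ.≤ j → + i ≡ x → + j ≡ y → 0ℤ ≤ y - x
  slack i≤j refl refl = i≤j⇒0≤j-i (+≤+ i≤j)

  pos-+₃ : ∀ a b d → + (a ℕ.+ b ℕ.+ d) ≡ + a + + b + + d
  pos-+₃ a b d = trans (pos-+ (a ℕ.+ b) d) (cong (_+ + d) (pos-+ a b))

euler-arithmetic : ∀ {e v v′ c fc s kA kB rA rB : ℕ} →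
  kA ℕ.+ fc ℕ.≤ c ℕ.+ 1 ℕ.+ rA → kB ℕ.+ fc ℕ.≤ c ℕ.+ 1 ℕ.+ rB →
  rA ℕ.+ rB ℕ.≤ s ℕ.+ fc → v ℕ.≤ c ℕ.+ v′ →
  ((+ e - + (c ℕ.+ v′)) + + kA) + ((+ e - + (c ℕ.+ v′)) + + kB)
    ≤ ((((+ s) - (+ v - + e)) + (+ c)) - ((+ v′ - + e) + + fc)) + (+ 2)
euler-arithmetic {e} {v} {v′} {c} {fc} {s} {kA} {kB} {rA} {rB} hA hB hR hv =
  ≤-trans (≤-reflexive (sym (+-identityʳ lhs)))
    (≤-trans (+-monoʳ-≤ lhs (+-mono-≤ (+-mono-≤ (+-mono-≤ δA δB) δR) δv)) (≤-reflexive balance))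
  where
  lhs = ((+ e - + (c ℕ.+ v′)) + + kA) + ((+ e - + (c ℕ.+ v′)) + + kB)
  δA : 0ℤ ≤ (+ c + + 1 + + rA) - (+ kA + + fc)
  δA = slack hA (pos-+ kA fc) (pos-+₃ c 1 rA)
  δB : 0ℤ ≤ (+ c + + 1 + + rB) - (+ kB + + fc)
  δB = slack hB (pos-+ kB fc) (pos-+₃ c 1 rB)
  δR : 0ℤ ≤ (+ s + + fc) - (+ rA + + rB)
  δR = slack hR (pos-+ rA rB) (pos-+ s fc)
  δv : 0ℤ ≤ (+ c + + v′) - + v
  δv = slack hv refl (pos-+ c v′)
  identity : ∀ e v v′ c fc s kA kB rA rB →
    ((e - (c + v′)) + kA) + ((e - (c + v′)) + kB)
      + ((((c + + 1 + rA) - (kA + fc)) + ((c + + 1 + rB) - (kB + fc)) + ((s + fc) - (rA + rB))) + ((c + v′) - v))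
    ≡ (((s - (v - e)) + c) - ((v′ - e) + fc)) + + 2
  identity = solve-∀
  slacks = (((+ c + + 1 + + rA) - (+ kA + + fc)) + ((+ c + + 1 + + rB) - (+ kB + + fc))
             + ((+ s + + fc) - (+ rA + + rB))) + ((+ c + + v′) - + v)
  balance : lhs + slacks ≡ ((((+ s) - (+ v - + e)) + (+ c)) - ((+ v′ - + e) + + fc)) + (+ 2)
  balance = trans (cong (λ w → ((+ e - w) + + kA) + ((+ e - w) + + kB) + slacks) (pos-+ c v′))
              (identity (+ e) (+ v) (+ v′) (+ c) (+ fc) (+ s) (+ kA) (+ kB) (+ rA) (+ rB))

lemma5p8 : (M : Map) (D : Diagram M) (χG χF : ℤ) (c s bA bB : ℕ) →
    EulerChar (graphG M D) χG → SurfaceEuler M χF → CrossingNumber M D c →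
    DualComponents M D s → Betti1 (S-A M D) bA → Betti1 (S-B M D) bB →
    (+ bA) + (+ bB) ≤ ((((+ s) - χG) + (+ c)) - χF) + (+ 2)
lemma5p8 M D χG χF c s bA bB (v , e , G-vertices , G-edges , χG≡)
  (v′ , e′ , fc , vertices , edges , faces , χF≡) crossings dual
  (vA , eA , kA , A-vertices , A-edges , A-components , bA≡)
  (vB , eB , kB , B-vertices , B-edges , B-components , bB≡)
  rewrite χG≡ | χF≡
        | classes-unique A-edges G-edges | classes-unique B-edges G-edges | classes-unique edges G-edges
        | Restoring.vertices-smoothing M D crossings false A-vertices vertices
        | Restoring.vertices-smoothing M D crossings true B-vertices vertices =
  subst₂ (λ x y → x + y ≤ _) (sym bA≡) (sym bB≡) $ euler-arithmetic {e} {v} {v′} {c} {fc} {s} {kA} {kB}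
    (components-smoothing false A-components faces) (components-smoothing true B-components faces)
    (regions-smoothings dual faces) (spatial-vertices G-vertices vertices)
  where open Restoring M D crossings
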